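{- Let $G$ be a finite simple connected edge-transitive graph that has at least one perfect matching, and let $F(G)$ denote its maximum forcing number. Then \[\mathrm{cf}(G) \ge \frac{2|E(G)|}{|V(G)|}F(G).\]
   Context: A graph is edge-transitive if its automorphism group acts transitively on its edge set. A perfect matching of $G$ is a set of pairwise disjoint edges covering every vertex. For a perfect matching $M$, a subset $S\subseteq M$ is a forcing set of $M$ if $M$ is the unique perfect matching of $G$ containing $S$; the forcing number $f(M)$ is the minimum size of a forcing set of $M$, and $F(G)$ is the maximum of $f(M)$ over all perfect matchings $M$ of $G$. A subset $S\subseteq E(G)$ is a complete forcing set of $G$ if for every perfect matching $M$ of $G$, the set $S\cap M$ is a forcing set of $M$. The complete forcing number $\mathrm{cf}(G)$ is the minimum size of a complete forcing set of $G$. -}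

module Defs where

open import Data.Nat using (ℕ; _≤_)
open import Data.Fin using (Fin)
open import Data.Fin.Subset using (Subset; _∈_; _⊆_; _∩_; ∣_∣)
open import Data.Fin.Permutation using (Permutation′; _⟨$⟩ʳ_)
open import Data.Product using (Σ; _×_; _,_; proj₁; proj₂; ∃)
open import Data.Sum using (_⊎_)
open import Relation.Binary.PropositionalEquality using (_≡_; _≢_)
open import Relation.Nullary using (¬_)

-- Edge e has (unordered) endpoints ends e = (u , v), with u ≢ v (no loops),
-- and distinct edges have distinct unordered endpoint pairs (no multi-edges).
SamePair : {n : ℕ} → Fin n × Fin n → Fin n × Fin n → Set
SamePair (a , b) (c , d) = (a ≡ c × b ≡ d) ⊎ (a ≡ d × b ≡ c)

record Graph : Set where
  field
    n     : ℕ
    m     : ℕ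
    ends  : Fin m → Fin n × Fin n
    loopless : ∀ e → proj₁ (ends e) ≢ proj₂ (ends e)
    simple   : ∀ e e′ → SamePair (ends e) (ends e′) → e ≡ e′

module _ (G : Graph) where
  open Graph G

  Incident : Fin n → Fin m → Set
  Incident v e = v ≡ proj₁ (ends e) ⊎ v ≡ proj₂ (ends e)

  Adjacent : Fin n → Fin n → Set
  Adjacent u v = ∃ λ e → SamePair (ends e) (u , v)

  data Walk : Fin n → Fin n → Set where
    here  : ∀ {u} → Walk u u
    step  : ∀ {u w v} → Adjacent u w → Walk w v → Walk u v

  Connected : Set
  Connected = ∀ u v → Walk u v

  IsAutomorphism : Permutation′ n → Set
  IsAutomorphism σ = ∀ u v → (Adjacent u v → Adjacent (σ ⟨$⟩ʳ u) (σ ⟨$⟩ʳ v))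
                           × (Adjacent (σ ⟨$⟩ʳ u) (σ ⟨$⟩ʳ v) → Adjacent u v)

  EdgeTransitive : Set
  EdgeTransitive = ∀ e e′ → Σ (Permutation′ n) λ σ → IsAutomorphism σ ×
    SamePair (σ ⟨$⟩ʳ proj₁ (ends e) , σ ⟨$⟩ʳ proj₂ (ends e)) (ends e′)

  IsPerfectMatching : Subset m → Set
  IsPerfectMatching M = ∀ v → (∃ λ e → e ∈ M × Incident v e)
                            × (∀ e e′ → e ∈ M → e′ ∈ M → Incident v e → Incident v e′ → e ≡ e′)

  HasPerfectMatching : Set
  HasPerfectMatching = ∃ IsPerfectMatching

  IsForcingSet : Subset m → Subset m → Set
  IsForcingSet M S = S ⊆ M × (∀ M′ → IsPerfectMatching M′ → S ⊆ M′ → M′ ≡ M)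

  IsForcingNumber : Subset m → ℕ → Set
  IsForcingNumber M k = (∃ λ S → IsForcingSet M S × ∣ S ∣ ≡ k)
                      × (∀ S → IsForcingSet M S → k ≤ ∣ S ∣)

  IsMaxForcingNumber : ℕ → Set
  IsMaxForcingNumber k = (∃ λ M → IsPerfectMatching M × IsForcingNumber M k)
                       × (∀ M j → IsPerfectMatching M → IsForcingNumber M j → j ≤ k)

  IsCompleteForcingSet : Subset m → Set
  IsCompleteForcingSet S = ∀ M → IsPerfectMatching M → IsForcingSet M (S ∩ M)

  IsCompleteForcingNumber : ℕ → Set
  IsCompleteForcingNumber k = (∃ λ S → IsCompleteForcingSet S × ∣ S ∣ ≡ k)
                            × (∀ S → IsCompleteForcingSet S → k ≤ ∣ S ∣)

-- Let 𝓜 be the set of perfect matchings of forcing number at least F, and let c(e) be the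
-- number of members of 𝓜 containing the edge e. Automorphisms permute 𝓜, so by
-- edge-transitivity c is constant. Counting the pairs e ∈ M ∈ 𝓜 gives m·c = |𝓜|·n/2; counting
-- those with e ∈ S as well, for a complete forcing set S, gives |S|·c = Σ_{M ∈ 𝓜} |S ∩ M|,
-- which is at least |𝓜|·F because S ∩ M forces M. Eliminating c yields 2mF ≤ n|S|.

module Submission where

open import Defs
open import Data.Bool using (Bool; true; false; _∧_; if_then_else_)
open import Data.Empty using (⊥-elim)
open import Data.Fin using (Fin; zero; suc; punchIn)
open import Data.Fin.Permutation using (Permutation′; permutation; flip; _⟨$⟩ʳ_; _⟨$⟩ˡ_; inverseˡ; inverseʳ)
open import Data.Fin.Properties using (punchInᵢ≢i; 2↔Bool)
open import Data.Fin.Subset using (Subset; _∈_; _∉_; _⊆_; _∩_; ∣_∣; ⊤; ⁅_⁆)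
open import Data.Fin.Subset.Properties using (∩-identityˡ; ∣⊤∣≡n; ∣⁅x⁆∣≡1; x∈⁅x⁆; x∈⁅y⁆⇒x≡y; _∈?_)
open import Data.Nat using (ℕ; zero; suc; _+_; _*_; _^_; _≤_; _≤?_; z≤n; >-nonZero)
open import Data.Nat.Properties
open import Data.Product using (∃; _×_; _,_; proj₁; proj₂)
open import Data.Sum using (_⊎_; inj₁; inj₂)
open import Data.Vec using ([]; _∷_; lookup; tabulate)
open import Data.Vec.Properties using (lookup∘tabulate; tabulate∘lookup; tabulate-cong; lookup-zipWith; []=⇒lookup; lookup⇒[]=)
open import Data.Vec.Recursive using (lift↔; Fin[m^n]↔Fin[m]^n)
open import Data.Vec.Recursive.Properties using (↔Vec)
open import Function using (_∘_; _↔_; Inverse; mk↔ₛ′; mk⇔)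
open import Function.Properties.Inverse using (↔-trans; ↔-sym)
open import Relation.Binary.PropositionalEquality
open import Relation.Nullary using (¬_; Dec; yes; no; does)
open import Relation.Nullary.Decidable using (decidable-stable; ¬¬-excluded-middle; dec-true; does-⇔)
open import Relation.Nullary.Negation using (¬¬-map)
open import Algebra.Properties.CommutativeSemigroup *-commutativeSemigroup using (x∙yz≈y∙xz; x∙yz≈y∙zx)
open import Algebra.Properties.Semiring.Sum +-*-semiring
  using (sum; sum-cong-≗; sum-remove; sum-permute; sum-replicate-zero; ∑-comm; ∑-distrib-+; *-distribˡ-sum; *-distribʳ-sum)

sum-mono-≤ : ∀ {k} {f g : Fin k → ℕ} → (∀ i → f i ≤ g i) → sum f ≤ sum g
sum-mono-≤ {zero}  f≤g = z≤n
sum-mono-≤ {suc k} f≤g = +-mono-≤ (f≤g zero) (sum-mono-≤ (f≤g ∘ suc))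

≤-sum : ∀ {k} (f : Fin k → ℕ) i → f i ≤ sum f
≤-sum {suc k} f i = ≤-trans (m≤m+n (f i) _) (≤-reflexive (sym (sum-remove {i = i} f)))

sum-pointed : ∀ {k} (f : Fin k → ℕ) i → (∀ j → j ≢ i → f j ≡ 0) → sum f ≡ f i
sum-pointed {suc k} f i f≡0 = begin
  sum f                        ≡⟨ sum-remove {i = i} f ⟩
  f i + sum (f ∘ punchIn i)    ≡⟨ cong (f i +_) (sum-cong-≗ (λ j → f≡0 _ (punchInᵢ≢i i j))) ⟩
  f i + sum {k} (λ _ → 0)      ≡⟨ cong (f i +_) (sum-replicate-zero k) ⟩
  f i + 0                      ≡⟨ +-identityʳ (f i) ⟩
  f i                          ∎
  where open ≡-Reasoning

sum-const : ∀ k c → sum {k} (λ _ → c) ≡ k * c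
sum-const zero    c = refl
sum-const (suc k) c = cong (c +_) (sum-const k c)

𝟙 : Bool → ℕ
𝟙 b = if b then 1 else 0

𝟙-∧ : ∀ a b → 𝟙 (a ∧ b) ≡ 𝟙 a * 𝟙 b
𝟙-∧ true  b = sym (+-identityʳ (𝟙 b))
𝟙-∧ false b = refl

module _ {A : Set} where

  𝟙-does-*-mono-≤ : ∀ (a? : Dec A) {x y} → (A → x ≤ y) → 𝟙 (does a?) * x ≤ 𝟙 (does a?) * y
  𝟙-does-*-mono-≤ (yes a) x≤y = *-monoʳ-≤ 1 (x≤y a)
  𝟙-does-*-mono-≤ (no _)  _   = z≤n

  𝟙-does-*-cong : ∀ (a? : Dec A) {x y} → (A → x ≡ y) → 𝟙 (does a?) * x ≡ 𝟙 (does a?) * y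
  𝟙-does-*-cong (yes a) x≡y = cong (1 *_) (x≡y a)
  𝟙-does-*-cong (no _)  _   = refl

module _ {m : ℕ} where

  indicator : Subset m → Fin m → ℕ
  indicator X e = 𝟙 (lookup X e)

  ∈⇒indicator≡1 : ∀ {X e} → e ∈ X → indicator X e ≡ 1
  ∈⇒indicator≡1 e∈X = cong 𝟙 ([]=⇒lookup e∈X)

  ∉⇒indicator≡0 : ∀ {X e} → e ∉ X → indicator X e ≡ 0
  ∉⇒indicator≡0 {X} {e} e∉X with lookup X e in eq
  ... | true  = ⊥-elim (e∉X (lookup⇒[]= e X eq))
  ... | false = refl

  indicator-∩ : ∀ X Y e → indicator (X ∩ Y) e ≡ indicator X e * indicator Y e
  indicator-∩ X Y e = trans (cong 𝟙 (lookup-zipWith _∧_ e X Y)) (𝟙-∧ (lookup X e) (lookup Y e))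

  indicator⁅⁆-≡ : ∀ {a v : Fin m} → v ≡ a → indicator ⁅ a ⁆ v ≡ 1
  indicator⁅⁆-≡ {a} refl = ∈⇒indicator≡1 {⁅ a ⁆} (x∈⁅x⁆ a)

  indicator⁅⁆-≢ : ∀ {a v : Fin m} → v ≢ a → indicator ⁅ a ⁆ v ≡ 0
  indicator⁅⁆-≢ {a} v≢a = ∉⇒indicator≡0 (v≢a ∘ x∈⁅y⁆⇒x≡y a)

∣∣≡∑indicator : ∀ {m} (X : Subset m) → ∣ X ∣ ≡ sum (indicator X)
∣∣≡∑indicator []          = refl
∣∣≡∑indicator (true ∷ X)  = cong suc (∣∣≡∑indicator X)
∣∣≡∑indicator (false ∷ X) = ∣∣≡∑indicator X

image : ∀ {m} → Permutation′ m → Subset m → Subset m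
image π X = tabulate (λ e → lookup X (π ⟨$⟩ˡ e))

module _ {m : ℕ} (π : Permutation′ m) where

  ∈-image⁺ : ∀ {X e} → e ∈ X → π ⟨$⟩ʳ e ∈ image π X
  ∈-image⁺ {X} {e} e∈X = lookup⇒[]= (π ⟨$⟩ʳ e) (image π X)
    (trans (lookup∘tabulate _ (π ⟨$⟩ʳ e)) (trans (cong (lookup X) (inverseˡ π)) ([]=⇒lookup e∈X)))

  ∈-image⁻ : ∀ {X e} → e ∈ image π X → π ⟨$⟩ˡ e ∈ X
  ∈-image⁻ {X} {e} e∈πX = lookup⇒[]= (π ⟨$⟩ˡ e) X (trans (sym (lookup∘tabulate _ e)) ([]=⇒lookup e∈πX))

  image-flip-image : ∀ X → image (flip π) (image π X) ≡ X
  image-flip-image X = trans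
    (tabulate-cong (λ e → trans (lookup∘tabulate _ (π ⟨$⟩ʳ e)) (cong (lookup X) (inverseˡ π))))
    (tabulate∘lookup X)

  ∣image∣ : ∀ X → ∣ image π X ∣ ≡ ∣ X ∣
  ∣image∣ X = begin
    ∣ image π X ∣                          ≡⟨ ∣∣≡∑indicator (image π X) ⟩
    sum (indicator (image π X))            ≡⟨ sum-cong-≗ (λ e → cong 𝟙 (lookup∘tabulate (lookup X ∘ (π ⟨$⟩ˡ_)) e)) ⟩
    sum (indicator X ∘ (π ⟨$⟩ˡ_))          ≡⟨ sum-permute (indicator X) (flip π) ⟨
    sum (indicator X)                      ≡⟨ ∣∣≡∑indicator X ⟨
    ∣ X ∣                                  ∎
    where open ≡-Reasoning

image↔ : ∀ {m} → Permutation′ m → Subset m ↔ Subset m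
image↔ π = mk↔ₛ′ (image π) (image (flip π)) (image-flip-image (flip π)) (image-flip-image π)

subsets↔ : ∀ m → Fin (2 ^ m) ↔ Subset m
subsets↔ m = ↔-trans (Fin[m^n]↔Fin[m]^n 2 m) (↔-trans (lift↔ m 2↔Bool) (↔Vec m))

∑Subsets : ∀ {m} → (Subset m → ℕ) → ℕ
∑Subsets {m} f = sum (f ∘ Inverse.to (subsets↔ m))

module _ {m : ℕ} where
  open Inverse (subsets↔ m) using (to; from; strictlyInverseˡ)

  ≤-∑Subsets : ∀ (f : Subset m → ℕ) X → f X ≤ ∑Subsets f
  ≤-∑Subsets f X = subst (λ Y → f Y ≤ ∑Subsets f) (strictlyInverseˡ X) (≤-sum (f ∘ to) (from X))

  ∑Subsets-mono-≤ : ∀ {f g : Subset m → ℕ} → (∀ X → f X ≤ g X) → ∑Subsets f ≤ ∑Subsets g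
  ∑Subsets-mono-≤ f≤g = sum-mono-≤ (f≤g ∘ to)

  ∑Subsets-cong : ∀ {f g : Subset m → ℕ} → (∀ X → f X ≡ g X) → ∑Subsets f ≡ ∑Subsets g
  ∑Subsets-cong f≡g = sum-cong-≗ (f≡g ∘ to)

  *-distribˡ-∑Subsets : ∀ c (f : Subset m → ℕ) → c * ∑Subsets f ≡ ∑Subsets (λ X → c * f X)
  *-distribˡ-∑Subsets c f = *-distribˡ-sum c (f ∘ to)

  *-distribʳ-∑Subsets : ∀ c (f : Subset m → ℕ) → ∑Subsets f * c ≡ ∑Subsets (λ X → f X * c)
  *-distribʳ-∑Subsets c f = *-distribʳ-sum c (f ∘ to)

  ∑Subsets-reindex : ∀ (g : Subset m ↔ Subset m) (f : Subset m → ℕ) → ∑Subsets (f ∘ Inverse.to g) ≡ ∑Subsets f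
  ∑Subsets-reindex g f = sym (trans (sum-permute (f ∘ to) (↔-trans (subsets↔ m) (↔-trans g (↔-sym (subsets↔ m)))))
                                    (sum-cong-≗ (λ i → cong f (strictlyInverseˡ (Inverse.to g (to i))))))

constant⇒≡const : ∀ {k} (f : Fin k → ℕ) → (∀ i j → f i ≡ f j) → ∃ λ c → ∀ i → f i ≡ c
constant⇒≡const {zero}  f _        = 0 , λ ()
constant⇒≡const {suc k} f constant = f zero , λ i → constant i zero

module Coverage {m : ℕ} (w : Subset m → ℕ) where

  coverage : Fin m → ℕ
  coverage e = ∑Subsets (λ X → w X * indicator X e)

  coverage-image : ∀ π → (∀ X → w (image π X) ≡ w X) → ∀ e → coverage (π ⟨$⟩ʳ e) ≡ coverage e
  coverage-image π w-image e = begin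
    ∑Subsets (λ X → w X * indicator X (π ⟨$⟩ʳ e))
      ≡⟨ ∑Subsets-reindex (image↔ π) (λ X → w X * indicator X (π ⟨$⟩ʳ e)) ⟨
    ∑Subsets (λ X → w (image π X) * indicator (image π X) (π ⟨$⟩ʳ e))
      ≡⟨ ∑Subsets-cong (λ X → cong₂ _*_ (w-image X) (cong 𝟙 (lookup-image X))) ⟩
    ∑Subsets (λ X → w X * indicator X e) ∎
    where
    open ≡-Reasoning
    lookup-image : ∀ X → lookup (image π X) (π ⟨$⟩ʳ e) ≡ lookup X e
    lookup-image X = trans (lookup∘tabulate (lookup X ∘ (π ⟨$⟩ˡ_)) (π ⟨$⟩ʳ e)) (cong (lookup X) (inverseˡ π))

  ∑Subsets-w*∣∩∣ : ∀ {c} → (∀ e → coverage e ≡ c) → ∀ S → ∑Subsets (λ X → w X * ∣ S ∩ X ∣) ≡ ∣ S ∣ * c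
  ∑Subsets-w*∣∩∣ {c} coverage≡c S = begin
    ∑Subsets (λ X → w X * ∣ S ∩ X ∣)
      ≡⟨ ∑Subsets-cong w*∣∩∣ ⟩
    ∑Subsets (λ X → sum (λ e → indicator S e * (w X * indicator X e)))
      ≡⟨ ∑-comm (λ i e → indicator S e * (w (to i) * indicator (to i) e)) ⟩
    sum (λ e → ∑Subsets (λ X → indicator S e * (w X * indicator X e)))
      ≡⟨ sum-cong-≗ (λ e → *-distribˡ-sum (indicator S e) (λ i → w (to i) * indicator (to i) e)) ⟨
    sum (λ e → indicator S e * coverage e)
      ≡⟨ sum-cong-≗ (λ e → cong (indicator S e *_) (coverage≡c e)) ⟩
    sum (λ e → indicator S e * c)
      ≡⟨ *-distribʳ-sum c (indicator S) ⟨
    sum (indicator S) * c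
      ≡⟨ cong (_* c) (∣∣≡∑indicator S) ⟨
    ∣ S ∣ * c ∎
    where
    open ≡-Reasoning
    open Inverse (subsets↔ m) using (to)
    w*∣∩∣ : ∀ X → w X * ∣ S ∩ X ∣ ≡ sum (λ e → indicator S e * (w X * indicator X e))
    w*∣∩∣ X = begin
      w X * ∣ S ∩ X ∣                                   ≡⟨ cong (w X *_) (∣∣≡∑indicator (S ∩ X)) ⟩
      w X * sum (indicator (S ∩ X))                     ≡⟨ *-distribˡ-sum (w X) (indicator (S ∩ X)) ⟩
      sum (λ e → w X * indicator (S ∩ X) e)             ≡⟨ sum-cong-≗ (λ e → cong (w X *_) (indicator-∩ S X e)) ⟩
      sum (λ e → w X * (indicator S e * indicator X e)) ≡⟨ sum-cong-≗ (λ e → x∙yz≈y∙xz (w X) (indicator S e) (indicator X e)) ⟩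
      sum (λ e → indicator S e * (w X * indicator X e)) ∎

¬¬-decidable-subsets : ∀ {m} (P : Subset m → Set) → ¬ ¬ (∀ X → Dec (P X))
¬¬-decidable-subsets {zero}  P ¬dec = ¬¬-excluded-middle λ P[]? → ¬dec λ { [] → P[]? }
¬¬-decidable-subsets {suc m} P ¬dec =
  ¬¬-decidable-subsets (P ∘ (true ∷_))  λ inside? →
  ¬¬-decidable-subsets (P ∘ (false ∷_)) λ outside? →
  ¬dec λ { (true ∷ X) → inside? X ; (false ∷ X) → outside? X }

averaging-bound : ∀ {T F s c m n} → 1 ≤ T → T * F ≤ s * c → T * n ≡ 2 * (m * c) → 2 * m * F ≤ n * s
averaging-bound {T} {F} {s} {c} {m} {n} T≥1 TF≤sc Tn≡2mc = *-cancelˡ-≤ T {{>-nonZero T≥1}} (begin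
  T * (2 * m * F)      ≡⟨ x∙yz≈y∙xz T (2 * m) F ⟩
  2 * m * (T * F)      ≤⟨ *-monoʳ-≤ (2 * m) TF≤sc ⟩
  2 * m * (s * c)      ≡⟨ x∙yz≈y∙xz (2 * m) s c ⟩
  s * (2 * m * c)      ≡⟨ cong (s *_) (*-assoc 2 m c) ⟩
  s * (2 * (m * c))    ≡⟨ cong (s *_) Tn≡2mc ⟨
  s * (T * n)          ≡⟨ x∙yz≈y∙zx s T n ⟩
  T * (n * s)          ∎)
  where open ≤-Reasoning

module _ {k : ℕ} where

  Endpoint : Fin k → Fin k × Fin k → Set
  Endpoint v p = v ≡ proj₁ p ⊎ v ≡ proj₂ p

  SamePair-sym : ∀ {p q : Fin k × Fin k} → SamePair p q → SamePair q p
  SamePair-sym (inj₁ (a≡c , b≡d)) = inj₁ (sym a≡c , sym b≡d)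
  SamePair-sym (inj₂ (a≡d , b≡c)) = inj₂ (sym b≡c , sym a≡d)

  SamePair-trans : ∀ {p q r : Fin k × Fin k} → SamePair p q → SamePair q r → SamePair p r
  SamePair-trans (inj₁ (a≡c , b≡d)) (inj₁ (c≡e , d≡f)) = inj₁ (trans a≡c c≡e , trans b≡d d≡f)
  SamePair-trans (inj₁ (a≡c , b≡d)) (inj₂ (c≡f , d≡e)) = inj₂ (trans a≡c c≡f , trans b≡d d≡e)
  SamePair-trans (inj₂ (a≡d , b≡c)) (inj₁ (c≡e , d≡f)) = inj₂ (trans a≡d d≡f , trans b≡c c≡e)
  SamePair-trans (inj₂ (a≡d , b≡c)) (inj₂ (c≡f , d≡e)) = inj₁ (trans a≡d d≡e , trans b≡c c≡f)

  SamePair-map : ∀ (f : Fin k → Fin k) {a b c d} → SamePair (a , b) (c , d) → SamePair (f a , f b) (f c , f d)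
  SamePair-map f (inj₁ (a≡c , b≡d)) = inj₁ (cong f a≡c , cong f b≡d)
  SamePair-map f (inj₂ (a≡d , b≡c)) = inj₂ (cong f a≡d , cong f b≡c)

  Endpoint-SamePair : ∀ {v} {p q : Fin k × Fin k} → SamePair p q → Endpoint v p → Endpoint v q
  Endpoint-SamePair (inj₁ (a≡c , _))   (inj₁ v≡a) = inj₁ (trans v≡a a≡c)
  Endpoint-SamePair (inj₁ (_ , b≡d))   (inj₂ v≡b) = inj₂ (trans v≡b b≡d)
  Endpoint-SamePair (inj₂ (a≡d , _))   (inj₁ v≡a) = inj₂ (trans v≡a a≡d)
  Endpoint-SamePair (inj₂ (_ , b≡c))   (inj₂ v≡b) = inj₁ (trans v≡b b≡c)

  Endpoint-map : ∀ (f : Fin k → Fin k) {v a b} → Endpoint v (a , b) → Endpoint (f v) (f a , f b)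
  Endpoint-map f (inj₁ v≡a) = inj₁ (cong f v≡a)
  Endpoint-map f (inj₂ v≡b) = inj₂ (cong f v≡b)

module _ (G : Graph) where
  open Graph G

  PreservesAdjacency : (Fin n → Fin n) → Set
  PreservesAdjacency f = ∀ {u v} → Adjacent G u v → Adjacent G (f u) (f v)

  module _ {f : Fin n → Fin n} (f-adj : PreservesAdjacency f) where

    edgeMap : Fin m → Fin m
    edgeMap e = proj₁ (f-adj (e , inj₁ (refl , refl)))

    ends-edgeMap : ∀ e → SamePair (ends (edgeMap e)) (f (proj₁ (ends e)) , f (proj₂ (ends e)))
    ends-edgeMap e = proj₂ (f-adj (e , inj₁ (refl , refl)))

    incident-edgeMap : ∀ {v e} → Incident G v e → Incident G (f v) (edgeMap e)
    incident-edgeMap {e = e} v∈e = Endpoint-SamePair (SamePair-sym (ends-edgeMap e)) (Endpoint-map f v∈e)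

  edgeMap-inverse : ∀ {f g} (f-adj : PreservesAdjacency f) (g-adj : PreservesAdjacency g) →
                    (∀ v → g (f v) ≡ v) → ∀ e → edgeMap g-adj (edgeMap f-adj e) ≡ e
  edgeMap-inverse {f} {g} f-adj g-adj g∘f≡id e = simple _ e
    (SamePair-trans (ends-edgeMap g-adj (edgeMap f-adj e))
    (SamePair-trans (SamePair-map g (ends-edgeMap f-adj e))
                    (inj₁ (g∘f≡id (proj₁ (ends e)) , g∘f≡id (proj₂ (ends e))))))

  record Symmetry : Set where
    field
      onVertices : Permutation′ n
      onEdges    : Permutation′ m
      incident   : ∀ {v e} → Incident G v e → Incident G (onVertices ⟨$⟩ʳ v) (onEdges ⟨$⟩ʳ e)
      incident⁻¹ : ∀ {v e} → Incident G v e → Incident G (onVertices ⟨$⟩ˡ v) (onEdges ⟨$⟩ˡ e)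

  Symmetry-inverse : Symmetry → Symmetry
  Symmetry-inverse s = record
    { onVertices = flip onVertices ; onEdges = flip onEdges ; incident = incident⁻¹ ; incident⁻¹ = incident }
    where open Symmetry s

  automorphism⇒symmetry : ∀ σ → IsAutomorphism G σ → Symmetry
  automorphism⇒symmetry σ σ-aut = record
    { onVertices = σ
    ; onEdges    = permutation (edgeMap σ-adj) (edgeMap σ⁻¹-adj)
                     (edgeMap-inverse σ⁻¹-adj σ-adj (λ _ → inverseʳ σ))
                     (edgeMap-inverse σ-adj σ⁻¹-adj (λ _ → inverseˡ σ))
    ; incident   = incident-edgeMap σ-adj
    ; incident⁻¹ = incident-edgeMap σ⁻¹-adj
    }
    where
    σ-adj : PreservesAdjacency (σ ⟨$⟩ʳ_)
    σ-adj {u} {v} = proj₁ (σ-aut u v)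
    σ⁻¹-adj : PreservesAdjacency (σ ⟨$⟩ˡ_)
    σ⁻¹-adj {u} {v} adj = proj₂ (σ-aut (σ ⟨$⟩ˡ u) (σ ⟨$⟩ˡ v))
      (subst₂ (Adjacent G) (sym (inverseʳ σ)) (sym (inverseʳ σ)) adj)

  edgeTransitive⇒symmetry : EdgeTransitive G → ∀ e e′ → ∃ λ s → Symmetry.onEdges s ⟨$⟩ʳ e ≡ e′
  edgeTransitive⇒symmetry edge-transitive e e′ with edge-transitive e e′
  ... | σ , σ-aut , σe≈e′ = automorphism⇒symmetry σ σ-aut ,
    simple _ e′ (SamePair-trans (ends-edgeMap (λ {u} {v} → proj₁ (σ-aut u v)) e) σe≈e′)

  module _ (s : Symmetry) where
    open Symmetry s
    private
      σ = onVertices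
      π = onEdges

    image-perfectMatching : ∀ {X} → IsPerfectMatching G X → IsPerfectMatching G (image π X)
    image-perfectMatching {X} X-pm v = covered , unique
      where
      covered : ∃ λ e → e ∈ image π X × Incident G v e
      covered with proj₁ (X-pm (σ ⟨$⟩ˡ v))
      ... | e , e∈X , σ⁻¹v∈e = π ⟨$⟩ʳ e , ∈-image⁺ π e∈X , subst (λ u → Incident G u (π ⟨$⟩ʳ e)) (inverseʳ σ) (incident σ⁻¹v∈e)
      unique : ∀ e e′ → e ∈ image π X → e′ ∈ image π X → Incident G v e → Incident G v e′ → e ≡ e′
      unique e e′ e∈πX e′∈πX v∈e v∈e′ = begin
        e                     ≡⟨ inverseʳ π ⟨
        π ⟨$⟩ʳ (π ⟨$⟩ˡ e)     ≡⟨ cong (π ⟨$⟩ʳ_) (proj₂ (X-pm (σ ⟨$⟩ˡ v)) _ _ (∈-image⁻ π e∈πX) (∈-image⁻ π e′∈πX)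
                                                   (incident⁻¹ v∈e) (incident⁻¹ v∈e′)) ⟩
        π ⟨$⟩ʳ (π ⟨$⟩ˡ e′)    ≡⟨ inverseʳ π ⟩
        e′                    ∎
        where open ≡-Reasoning

    image-forcingSet : ∀ {X S} → IsForcingSet G (image π X) S → IsForcingSet G X (image (flip π) S)
    image-forcingSet {X} {S} (S⊆πX , S-forces) = π⁻¹S⊆X , π⁻¹S-forces
      where
      π⁻¹S⊆X : image (flip π) S ⊆ X
      π⁻¹S⊆X e∈π⁻¹S = subst (_∈ X) (inverseˡ π) (∈-image⁻ π (S⊆πX (∈-image⁻ (flip π) e∈π⁻¹S)))
      π⁻¹S-forces : ∀ M → IsPerfectMatching G M → image (flip π) S ⊆ M → M ≡ X
      π⁻¹S-forces M M-pm π⁻¹S⊆M = begin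
        M                              ≡⟨ image-flip-image π M ⟨
        image (flip π) (image π M)     ≡⟨ cong (image (flip π)) (S-forces (image π M) (image-perfectMatching M-pm) S⊆πM) ⟩
        image (flip π) (image π X)     ≡⟨ image-flip-image π X ⟩
        X                              ∎
        where
        open ≡-Reasoning
        S⊆πM : S ⊆ image π M
        S⊆πM e∈S = subst (_∈ image π M) (inverseʳ π) (∈-image⁺ π (π⁻¹S⊆M (∈-image⁺ (flip π) e∈S)))

  ForcingAtLeast : ℕ → Subset m → Set
  ForcingAtLeast F M = IsPerfectMatching G M × (∀ S → IsForcingSet G M S → F ≤ ∣ S ∣)

  image-forcingAtLeast : ∀ s {F X} → ForcingAtLeast F X → ForcingAtLeast F (image (Symmetry.onEdges s) X)
  image-forcingAtLeast s {F} (X-pm , X-minimal) = image-perfectMatching s X-pm , λ S S-forces →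
    subst (F ≤_) (∣image∣ (flip π) S) (X-minimal (image (flip π) S) (image-forcingSet s S-forces))
    where π = Symmetry.onEdges s

  image-forcingAtLeast⁻ : ∀ s {F X} → ForcingAtLeast F (image (Symmetry.onEdges s) X) → ForcingAtLeast F X
  image-forcingAtLeast⁻ s {F} {X} = subst (ForcingAtLeast F) (image-flip-image (Symmetry.onEdges s) X)
                                  ∘ image-forcingAtLeast (Symmetry-inverse s)

  incidence : Fin n → Fin m → ℕ
  incidence v e = indicator ⁅ proj₁ (ends e) ⁆ v + indicator ⁅ proj₂ (ends e) ⁆ v

  ∑incidence : ∀ e → sum (λ v → incidence v e) ≡ 2
  ∑incidence e = begin
    sum (λ v → incidence v e)                            ≡⟨ ∑-distrib-+ (indicator ⁅ a ⁆) (indicator ⁅ b ⁆) ⟩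
    sum (indicator ⁅ a ⁆) + sum (indicator ⁅ b ⁆)        ≡⟨ cong₂ _+_ (∣∣≡∑indicator ⁅ a ⁆) (∣∣≡∑indicator ⁅ b ⁆) ⟨
    ∣ ⁅ a ⁆ ∣ + ∣ ⁅ b ⁆ ∣                                ≡⟨ cong₂ _+_ (∣⁅x⁆∣≡1 a) (∣⁅x⁆∣≡1 b) ⟩
    2                                                    ∎
    where
    open ≡-Reasoning
    a = proj₁ (ends e)
    b = proj₂ (ends e)

  incidence≡1 : ∀ {v e} → Incident G v e → incidence v e ≡ 1
  incidence≡1 {e = e} (inj₁ v≡a) =
    cong₂ _+_ (indicator⁅⁆-≡ v≡a) (indicator⁅⁆-≢ (λ v≡b → loopless e (trans (sym v≡a) v≡b)))
  incidence≡1 {e = e} (inj₂ v≡b) =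
    cong₂ _+_ (indicator⁅⁆-≢ (λ v≡a → loopless e (trans (sym v≡a) v≡b))) (indicator⁅⁆-≡ v≡b)

  incidence≡0 : ∀ {v e} → ¬ Incident G v e → incidence v e ≡ 0
  incidence≡0 v∉e = cong₂ _+_ (indicator⁅⁆-≢ (v∉e ∘ inj₁)) (indicator⁅⁆-≢ (v∉e ∘ inj₂))

  ∑matchedIncidence : ∀ {X} → IsPerfectMatching G X → ∀ v → sum (λ e → indicator X e * incidence v e) ≡ 1
  ∑matchedIncidence {X} X-pm v with proj₁ (X-pm v)
  ... | e₀ , e₀∈X , v∈e₀ =
    trans (sum-pointed _ e₀ unmatched) (cong₂ _*_ (∈⇒indicator≡1 e₀∈X) (incidence≡1 v∈e₀))
    where
    unmatched : ∀ e → e ≢ e₀ → indicator X e * incidence v e ≡ 0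
    unmatched e e≢e₀ with e ∈? X
    ... | no e∉X  = cong (_* incidence v e) (∉⇒indicator≡0 e∉X)
    ... | yes e∈X = trans (cong (indicator X e *_) (incidence≡0 (λ v∈e → e≢e₀ (proj₂ (X-pm v) e e₀ e∈X e₀∈X v∈e v∈e₀))))
                          (*-zeroʳ (indicator X e))

  perfectMatching-size : ∀ {X} → IsPerfectMatching G X → 2 * ∣ X ∣ ≡ n
  perfectMatching-size {X} X-pm = begin
    2 * ∣ X ∣                                                 ≡⟨ cong (2 *_) (∣∣≡∑indicator X) ⟩
    2 * sum (indicator X)                                     ≡⟨ *-distribˡ-sum 2 (indicator X) ⟩
    sum (λ e → 2 * indicator X e)                             ≡⟨ sum-cong-≗ (λ e → *-comm 2 (indicator X e)) ⟩
    sum (λ e → indicator X e * 2)                             ≡⟨ sum-cong-≗ (λ e → cong (indicator X e *_) (∑incidence e)) ⟨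
    sum (λ e → indicator X e * sum (λ v → incidence v e))     ≡⟨ sum-cong-≗ (λ e → *-distribˡ-sum (indicator X e) (λ v → incidence v e)) ⟩
    sum (λ e → sum (λ v → indicator X e * incidence v e))     ≡⟨ ∑-comm (λ e v → indicator X e * incidence v e) ⟩
    sum (λ v → sum (λ e → indicator X e * incidence v e))     ≡⟨ sum-cong-≗ (∑matchedIncidence X-pm) ⟩
    sum {n} (λ _ → 1)                                         ≡⟨ sum-const n 1 ⟩
    n * 1                                                     ≡⟨ *-identityʳ n ⟩
    n                                                         ∎
    where open ≡-Reasoning

  module Counting (F : ℕ) (forcing? : ∀ X → Dec (ForcingAtLeast F X)) where

    weight : Subset m → ℕ
    weight X = 𝟙 (does (forcing? X))

    open Coverage weight

    weight-image : ∀ s X → weight (image (Symmetry.onEdges s) X) ≡ weight X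
    weight-image s X = cong 𝟙 (does-⇔ (mk⇔ (image-forcingAtLeast⁻ s) (image-forcingAtLeast s)) (forcing? _) (forcing? X))

    coverage-constant : EdgeTransitive G → ∀ e e′ → coverage e ≡ coverage e′
    coverage-constant edge-transitive e e′ with edgeTransitive⇒symmetry edge-transitive e′ e
    ... | s , πe′≡e = trans (cong coverage (sym πe′≡e)) (coverage-image (Symmetry.onEdges s) (weight-image s) e′)

    forcing-bound : EdgeTransitive G → ∀ {M S} → ForcingAtLeast F M → IsCompleteForcingSet G S → 2 * m * F ≤ n * ∣ S ∣
    forcing-bound edge-transitive {M} {S} M-forcing S-complete = averaging-bound {m = m} T≥1 TF≤Sc Tn≡2mc
      where
      c = proj₁ (constant⇒≡const coverage (coverage-constant edge-transitive))
      coverage≡c = proj₂ (constant⇒≡const coverage (coverage-constant edge-transitive))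
      T = ∑Subsets weight

      T≥1 : 1 ≤ T
      T≥1 = subst (_≤ T) (cong 𝟙 (dec-true (forcing? M) M-forcing)) (≤-∑Subsets weight M)

      TF≤Sc : T * F ≤ ∣ S ∣ * c
      TF≤Sc = begin
        T * F                                  ≡⟨ *-distribʳ-∑Subsets F weight ⟩
        ∑Subsets (λ X → weight X * F)          ≤⟨ ∑Subsets-mono-≤ (λ X → 𝟙-does-*-mono-≤ (forcing? X)
                                                    λ (X-pm , X-minimal) → X-minimal (S ∩ X) (S-complete X X-pm)) ⟩
        ∑Subsets (λ X → weight X * ∣ S ∩ X ∣)  ≡⟨ ∑Subsets-w*∣∩∣ coverage≡c S ⟩
        ∣ S ∣ * c                              ∎
        where open ≤-Reasoning

      Tn≡2mc : T * n ≡ 2 * (m * c)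
      Tn≡2mc = begin
        T * n                                        ≡⟨ *-distribʳ-∑Subsets n weight ⟩
        ∑Subsets (λ X → weight X * n)                ≡⟨ ∑Subsets-cong (λ X → 𝟙-does-*-cong (forcing? X) λ (X-pm , _) →
                                                          trans (sym (perfectMatching-size X-pm)) (cong (λ Y → 2 * ∣ Y ∣) (sym (∩-identityˡ X)))) ⟩
        ∑Subsets (λ X → weight X * (2 * ∣ ⊤ ∩ X ∣))  ≡⟨ ∑Subsets-cong (λ X → x∙yz≈y∙xz (weight X) 2 ∣ ⊤ ∩ X ∣) ⟩
        ∑Subsets (λ X → 2 * (weight X * ∣ ⊤ ∩ X ∣))  ≡⟨ *-distribˡ-∑Subsets 2 (λ X → weight X * ∣ ⊤ ∩ X ∣) ⟨
        2 * ∑Subsets (λ X → weight X * ∣ ⊤ ∩ X ∣)    ≡⟨ cong (2 *_) (∑Subsets-w*∣∩∣ coverage≡c ⊤) ⟩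
        2 * (∣ ⊤ {m} ∣ * c)                          ≡⟨ cong (λ k → 2 * (k * c)) (∣⊤∣≡n m) ⟩
        2 * (m * c)                                  ∎
        where open ≡-Reasoning

-- ForcingAtLeast is not decided here; as the conclusion is decidable, ¬¬-decidability suffices.
theorem3 : (G : Graph) → Connected G → EdgeTransitive G → HasPerfectMatching G →
    (F cf : ℕ) → IsMaxForcingNumber G F → IsCompleteForcingNumber G cf →
    2 * Graph.m G * F ≤ Graph.n G * cf
theorem3 G _ edge-transitive _ F _ ((M , M-pm , _ , M-minimal) , _) ((S , S-complete , refl) , _) =
  decidable-stable (2 * m * F ≤? n * ∣ S ∣)
    (¬¬-map (λ forcing? → Counting.forcing-bound G F forcing? edge-transitive (M-pm , M-minimal) S-complete)
            (¬¬-decidable-subsets (ForcingAtLeast G F)))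
  where open Graph G
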